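{- Let $G$ be a finite graph on $n$ vertices with maximum degree $\Delta(G)<\frac{1}{9}n-\frac{1}{3}$. Then $V(G)$ can be partitioned into exactly $\chi(G)$ independent sets, each of size at least $4$.
   Context: $\chi(G)$ denotes the chromatic number of $G$; graphs are finite and simple. -}

module Defs where

open import Data.Nat using (ℕ; _⊔_; _<_)
open import Data.Bool using (Bool; true; false)
open import Data.Fin using (Fin)
open import Data.Fin.Properties using (_≟_)
open import Data.List using (List; length; filter; allFin; map; foldr)
open import Relation.Binary.PropositionalEquality using (_≡_)
open import Relation.Nullary using (¬_)
open import Data.Bool.Properties using () renaming (_≟_ to _≟B_)

record Graph (n : ℕ) : Set where
  field
    adj    : Fin n → Fin n → Bool
    sym    : ∀ u v → adj u v ≡ adj v u
    irrefl : ∀ v → adj v v ≡ false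
open Graph public

degree : ∀ {n} → Graph n → Fin n → ℕ
degree {n} G v = length (filter (λ u → adj G v u ≟B true) (allFin n))

maxDegree : ∀ {n} → Graph n → ℕ
maxDegree {n} G = foldr _⊔_ 0 (map (degree G) (allFin n))

-- a proper colouring with k colours: adjacent vertices get distinct colours
-- (equivalently, every colour class is an independent set)
Proper : ∀ {n k} → Graph n → (Fin n → Fin k) → Set
Proper G c = ∀ u v → adj G u v ≡ true → ¬ (c u ≡ c v)

Colourable : ∀ {n} → Graph n → ℕ → Set
Colourable {n} G k = Data.Product.Σ (Fin n → Fin k) (Proper G)
  where import Data.Product

IsChromaticNumber : ∀ {n} → Graph n → ℕ → Set
IsChromaticNumber G k = Colourable G k Data.Product.× (∀ m → m < k → ¬ Colourable G m)
  where import Data.Product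

classSize : ∀ {n k} → (Fin n → Fin k) → Fin k → ℕ
classSize {n} c i = length (filter (λ v → c v ≟ i) (allFin n))

{-# OPTIONS --safe #-}
-- Start from any proper χ-colouring and repeat the following while some colour class i₀
-- has at most t vertices (t = 3 for the theorem): move into i₀ a vertex v that has no
-- neighbour in i₀ and whose own class has more than t + 1 vertices. The colouring stays
-- proper, and Σᵢ max(0, t + 1 − |class i|) strictly decreases. Such a v exists whenever
-- t·Δ + (t + 1)·χ ≤ n, since at most t·Δ vertices have a neighbour in i₀ and fewer than
-- (t + 1)·χ vertices lie in classes of size at most t + 1. Finally χ ≤ Δ + 1, so the
-- hypothesis 9Δ + 3 < n leaves room for t = 3.
module Submission where

open import Defs hiding (sym)
open import Data.Nat using (ℕ; zero; suc; _+_; _*_; _∸_; _⊔_; _<_; _≤_; z≤n; s≤s)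
open import Data.Fin using (Fin)
open import Data.Product using (Σ; _×_)

open import Data.Bool using (true; if_then_else_)
open import Data.Bool.Properties using () renaming (_≟_ to _≟ᵇ_)
open import Data.Fin using (zero; suc; punchIn)
open import Data.Fin.Properties using (_≟_; any?; punchInᵢ≢i; ¬∀⟶∃¬)
open import Data.List using (length; filter; tabulate; foldr)
open import Data.List.Membership.Propositional using (_∈_)
open import Data.List.Membership.Propositional.Properties using (∈-map⁺; ∈-allFin)
open import Data.List.Relation.Unary.Any using (here; there)
open import Data.Nat.Induction using (<-wellFounded)
open import Data.Nat.Properties hiding (_≟_)
open import Data.Nat.Solver using (module +-*-Solver)
open import Data.Product using (∃; _,_; proj₁; proj₂)
open import Data.Sum using (_⊎_; inj₁; inj₂)
open import Data.Vec.Functional using (removeAt; updateAt)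
open import Data.Vec.Functional.Properties using (updateAt-updates; updateAt-minimal)
open import Function using (_∘_; id; const; _⇔_; mk⇔)
open import Induction.WellFounded using (Acc; acc)
open import Level using (Level)
open import Relation.Binary.PropositionalEquality
open import Relation.Nullary using (¬_; Dec; yes; no; does; _×-dec_; _⊎-dec_; contradiction)
open import Relation.Nullary.Decidable using (does-⇔)
open import Relation.Unary using (Pred; Decidable; _⊆_; _≐_)
open import Algebra.Properties.CommutativeSemigroup +-commutativeSemigroup using (x∙yz≈y∙xz)
open import Algebra.Properties.Semiring.Sum +-*-semiring
  using (sum; sum-syntax; sum-cong-≗; sum-remove; sum-replicate-zero; ∑-comm; ∑-distrib-+;
         *-distribʳ-sum)

private
  variable
    a p r : Level
    A B : Set a
    k m n χ : ℕ

𝟙 : Dec A → ℕ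
𝟙 a? = if does a? then 1 else 0

𝟙-mono : (a? : Dec A) (b? : Dec B) → (A → B) → 𝟙 a? ≤ 𝟙 b?
𝟙-mono (yes _) (yes _) _   = ≤-refl
𝟙-mono (yes a) (no ¬b) A→B = contradiction (A→B a) ¬b
𝟙-mono (no _)  _       _   = z≤n

𝟙-⇔ : (a? : Dec A) (b? : Dec B) → A ⇔ B → 𝟙 a? ≡ 𝟙 b?
𝟙-⇔ a? b? A⇔B = cong (if_then 1 else 0) (does-⇔ A⇔B a? b?)

𝟙-⊎ : (a? : Dec A) (b? : Dec B) → 𝟙 (a? ⊎-dec b?) ≤ 𝟙 a? + 𝟙 b?
𝟙-⊎ (yes _) _ = s≤s z≤n
𝟙-⊎ (no _)  _ = ≤-refl

𝟙*≤ : (a? : Dec A) {x y : ℕ} → (A → x ≤ y) → 𝟙 a? * x ≤ y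
𝟙*≤ (yes a) {x} A⇒x≤y = ≤-trans (≤-reflexive (+-identityʳ x)) (A⇒x≤y a)
𝟙*≤ (no _)      _     = z≤n

sum-const : ∀ k x → ∑[ i < k ] x ≡ k * x
sum-const zero    x = refl
sum-const (suc k) x = cong (x +_) (sum-const k x)

sum-mono-≤ : {f g : Fin k → ℕ} → (∀ i → f i ≤ g i) → sum f ≤ sum g
sum-mono-≤ {zero}  f≤g = z≤n
sum-mono-≤ {suc k} f≤g = +-mono-≤ (f≤g zero) (sum-mono-≤ (f≤g ∘ suc))

sum-mono-< : {f g : Fin k → ℕ} (j : Fin k) → (∀ i → f i ≤ g i) → f j < g j → sum f < sum g
sum-mono-< zero    f≤g fj<gj = +-mono-<-≤ fj<gj (sum-mono-≤ (f≤g ∘ suc))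
sum-mono-< (suc j) f≤g fj<gj = +-mono-≤-< (f≤g zero) (sum-mono-< j (f≤g ∘ suc) fj<gj)

count : {P : Pred (Fin k) p} → Decidable P → ℕ
count {k} P? = ∑[ i < k ] 𝟙 (P? i)

count-mono : {P : Pred (Fin k) p} {Q : Pred (Fin k) r} (P? : Decidable P) (Q? : Decidable Q) →
             P ⊆ Q → count P? ≤ count Q?
count-mono P? Q? P⊆Q = sum-mono-≤ λ i → 𝟙-mono (P? i) (Q? i) P⊆Q

count-cong : {P : Pred (Fin k) p} {Q : Pred (Fin k) r} (P? : Decidable P) (Q? : Decidable Q) →
             P ≐ Q → count P? ≡ count Q?
count-cong P? Q? (P⊆Q , Q⊆P) = ≤-antisym (count-mono P? Q? P⊆Q) (count-mono Q? P? Q⊆P)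

count-singleton : (x : Fin k) → count (x ≟_) ≡ 1
count-singleton {suc k} zero    = cong suc (sum-replicate-zero k)
count-singleton         (suc x) = count-singleton x

0<count : {P : Pred (Fin k) p} (P? : Decidable P) {i : Fin k} → P i → 0 < count P?
0<count P? {i} Pi = subst (_≤ count P?) (count-singleton i) (count-mono (i ≟_) P? λ { refl → Pi })

count<⇒∃¬ : {P : Pred (Fin k) p} (P? : Decidable P) → count P? < k → ∃ λ i → ¬ P i
count<⇒∃¬ {suc k} P? count<k with P? zero
... | no ¬P0 = zero , ¬P0
... | yes _  = let i , ¬Pi = count<⇒∃¬ (P? ∘ suc) (≤-pred count<k) in suc i , ¬Pi

count-∪ : {P : Pred (Fin k) p} {Q : Pred (Fin k) r} (P? : Decidable P) (Q? : Decidable Q) →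
          count (λ i → P? i ⊎-dec Q? i) ≤ count P? + count Q?
count-∪ P? Q? =
  ≤-trans (sum-mono-≤ λ i → 𝟙-⊎ (P? i) (Q? i)) (≤-reflexive (∑-distrib-+ (𝟙 ∘ P?) (𝟙 ∘ Q?)))

count-∃ : {R : Fin m → Pred (Fin k) p} (R? : ∀ a → Decidable (R a)) →
          count (λ i → any? λ a → R? a i) ≤ ∑[ a < m ] count (R? a)
count-∃ {zero}  {k} R? = ≤-reflexive (sum-replicate-zero k)
count-∃ {suc m}     R? = ≤-trans (count-∪ (R? zero) (λ i → any? λ a → R? (suc a) i))
                                 (+-monoʳ-≤ (count (R? zero)) (count-∃ (R? ∘ suc)))

count-×ˡ : {Q : Pred (Fin k) p} (a? : Dec A) (Q? : Decidable Q) →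
           count (λ i → a? ×-dec Q? i) ≡ 𝟙 a? * count Q?
count-×ˡ     (yes _) Q? = sym (+-identityʳ _)
count-×ˡ {k} (no _)  Q? = sum-replicate-zero k

count-fibres : {P : Pred (Fin k) p} (P? : Decidable P) (g : Fin k → Fin m) →
               count P? ≡ ∑[ j < m ] count (λ i → P? i ×-dec g i ≟ j)
count-fibres {k} {m = m} P? g = begin
  count P?                          ≡⟨ sum-cong-≗ 𝟙≡fibre ⟩
  ∑[ i < k ] ∑[ j < m ] 𝟙[ i , j ]  ≡⟨ ∑-comm 𝟙[_,_] ⟩
  ∑[ j < m ] ∑[ i < k ] 𝟙[ i , j ]  ∎
  where
  open ≡-Reasoning
  𝟙[_,_] : Fin k → Fin m → ℕ
  𝟙[ i , j ] = 𝟙 (P? i ×-dec g i ≟ j)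
  𝟙≡fibre : ∀ i → 𝟙 (P? i) ≡ ∑[ j < m ] 𝟙[ i , j ]
  𝟙≡fibre i = sym (begin
    count (λ j → P? i ×-dec g i ≟ j) ≡⟨ count-×ˡ (P? i) (g i ≟_) ⟩
    𝟙 (P? i) * count (g i ≟_)        ≡⟨ cong (𝟙 (P? i) *_) (count-singleton (g i)) ⟩
    𝟙 (P? i) * 1                     ≡⟨ *-identityʳ _ ⟩
    𝟙 (P? i)                         ∎)

count-cong-except : {P : Pred (Fin k) p} {Q : Pred (Fin k) r} (P? : Decidable P) (Q? : Decidable Q)
                    (v : Fin k) → (∀ {i} → i ≢ v → P i ⇔ Q i) →
                    𝟙 (Q? v) + count P? ≡ 𝟙 (P? v) + count Q?
count-cong-except {suc k} P? Q? v P⇔Q = begin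
  𝟙 (Q? v) + count P?             ≡⟨ cong (𝟙 (Q? v) +_) (sum-remove (𝟙 ∘ P?)) ⟩
  𝟙 (Q? v) + (𝟙 (P? v) + restP)   ≡⟨ cong (λ s → 𝟙 (Q? v) + (𝟙 (P? v) + s)) restP≡restQ ⟩
  𝟙 (Q? v) + (𝟙 (P? v) + restQ)   ≡⟨ x∙yz≈y∙xz (𝟙 (Q? v)) (𝟙 (P? v)) restQ ⟩
  𝟙 (P? v) + (𝟙 (Q? v) + restQ)   ≡⟨ cong (𝟙 (P? v) +_) (sum-remove (𝟙 ∘ Q?)) ⟨
  𝟙 (P? v) + count Q?             ∎
  where
  open ≡-Reasoning
  restP restQ : ℕ
  restP = sum (removeAt (𝟙 ∘ P?) v)
  restQ = sum (removeAt (𝟙 ∘ Q?) v)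
  restP≡restQ : restP ≡ restQ
  restP≡restQ = sum-cong-≗ λ j →
    𝟙-⇔ (P? (punchIn v j)) (Q? (punchIn v j)) (P⇔Q (punchInᵢ≢i v j))

length-filter-tabulate : {P : Pred A p} (P? : Decidable P) (f : Fin k → A) →
                         length (filter P? (tabulate f)) ≡ count (P? ∘ f)
length-filter-tabulate {k = zero}  P? f = refl
length-filter-tabulate {k = suc k} P? f with P? (f zero)
... | yes _ = cong suc (length-filter-tabulate P? (f ∘ suc))
... | no _  = length-filter-tabulate P? (f ∘ suc)

classSize≡count : (c : Fin n → Fin k) (i : Fin k) → classSize c i ≡ count (λ v → c v ≟ i)
classSize≡count c i = length-filter-tabulate (λ v → c v ≟ i) (λ v → v)

∈⇒≤-foldr-⊔ : ∀ {x xs} → x ∈ xs → x ≤ foldr _⊔_ 0 xs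
∈⇒≤-foldr-⊔ (here refl)  = m≤m⊔n _ _
∈⇒≤-foldr-⊔ (there x∈xs) = m≤n⇒m≤o⊔n _ (∈⇒≤-foldr-⊔ x∈xs)

degree≤maxDegree : (G : Graph n) (v : Fin n) → degree G v ≤ maxDegree G
degree≤maxDegree G v = ∈⇒≤-foldr-⊔ (∈-map⁺ (degree G) (∈-allFin v))

module _ (G : Graph n) where

  private
    Δ : ℕ
    Δ = maxDegree G

  neighbour? : (v : Fin n) → Decidable (λ u → adj G v u ≡ true)
  neighbour? v u = adj G v u ≟ᵇ true

  count-neighbour≤Δ : (v : Fin n) → count (neighbour? v) ≤ Δ
  count-neighbour≤Δ v =
    subst (_≤ Δ) (length-filter-tabulate (neighbour? v) (λ u → u)) (degree≤maxDegree G v)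

  missing-colour : (c : Fin n → Fin (suc m)) → Δ < m →
                   (v : Fin n) → ∃ λ j → ∀ u → adj G v u ≡ true → c u ≢ suc j
  missing-colour {m} c Δ<m v =
    let j , unseen = ¬∀⟶∃¬ m Seen seen? all-seen⇒⊥ in j , λ u v~u cu≡j → unseen (u , v~u , cu≡j)
    where
    Seen : Fin m → Set
    Seen j = ∃ λ u → adj G v u ≡ true × c u ≡ suc j
    neighbour-of-colour? : (j : Fin (suc m)) → Decidable (λ u → adj G v u ≡ true × c u ≡ j)
    neighbour-of-colour? j u = neighbour? v u ×-dec c u ≟ j
    seen? : Decidable Seen
    seen? j = any? (neighbour-of-colour? (suc j))
    all-seen⇒⊥ : ¬ (∀ j → Seen j)
    all-seen⇒⊥ all-seen = <⇒≱ Δ<m (begin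
      m                                                    ≡⟨ *-identityʳ m ⟨
      m * 1                                                ≡⟨ sum-const m 1 ⟨
      ∑[ j < m ] 1                                         ≤⟨ sum-mono-≤ seen⇒0<count ⟩
      ∑[ j < m ] count (neighbour-of-colour? (suc j))      ≤⟨ m≤n+m _ _ ⟩
      ∑[ j < suc m ] count (neighbour-of-colour? j)        ≡⟨ count-fibres (neighbour? v) c ⟨
      count (neighbour? v)                                 ≤⟨ count-neighbour≤Δ v ⟩
      Δ                                                    ∎)
      where
      open ≤-Reasoning
      seen⇒0<count : ∀ j → 0 < count (neighbour-of-colour? (suc j))
      seen⇒0<count j = let u , seen = all-seen j in 0<count (neighbour-of-colour? (suc j)) {u} seen

  -- Only the vertices of colour 0 are recoloured; they are pairwise non-adjacent, so each
  -- of them may independently take a colour missing from its neighbourhood.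
  lower-colouring : Δ < m → Colourable G (suc m) → Colourable G m
  lower-colouring {m} Δ<m (c , proper) = (λ u → lower u (c u)) , lower-proper
    where
    lower : Fin n → Fin (suc m) → Fin m
    lower u zero    = proj₁ (missing-colour c Δ<m u)
    lower u (suc j) = j
    lower-proper : Proper G (λ u → lower u (c u))
    lower-proper u w u~w with c u in cu≡ | c w in cw≡
    ... | zero  | zero   = λ _ → proper u w u~w (trans cu≡ (sym cw≡))
    ... | zero  | suc j  = λ j′≡j →
      proj₂ (missing-colour c Δ<m u) w u~w (trans cw≡ (cong suc (sym j′≡j)))
    ... | suc j | zero   = λ j≡j′ →
      proj₂ (missing-colour c Δ<m w) u (trans (Graph.sym G w u) u~w) (trans cu≡ (cong suc j≡j′))
    ... | suc j | suc j′ = λ j≡j′ →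
      proper u w u~w (trans cu≡ (trans (cong suc j≡j′) (sym cw≡)))

  χ≤1+Δ : IsChromaticNumber G χ → χ ≤ suc Δ
  χ≤1+Δ {zero}  _                      = z≤n
  χ≤1+Δ {suc m} (colourable , minimal) =
    ≮⇒≥ λ 1+Δ<1+m → minimal m ≤-refl (lower-colouring (≤-pred 1+Δ<1+m) colourable)

module Balancing (G : Graph n) (t : ℕ) where

  private
    Δ : ℕ
    Δ = maxDegree G

  size : (Fin n → Fin k) → Fin k → ℕ
  size c i = count (λ v → c v ≟ i)

  deficit : (Fin n → Fin k) → Fin k → ℕ
  deficit c i = suc t ∸ size c i

  imbalance : (Fin n → Fin k) → ℕ
  imbalance {k} c = ∑[ i < k ] deficit c i

  AdjacentToClass : (Fin n → Fin k) → Fin k → Fin n → Set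
  AdjacentToClass c i v = ∃ λ a → c a ≡ i × adj G a v ≡ true

  module _ (c : Fin n → Fin χ) (i₀ : Fin χ) (small : size c i₀ ≤ t) where

    classNeighbour? : (a : Fin n) → Decidable (λ v → c a ≡ i₀ × adj G a v ≡ true)
    classNeighbour? a v = c a ≟ i₀ ×-dec neighbour? G a v

    adjacentToClass? : Decidable (AdjacentToClass c i₀)
    adjacentToClass? v = any? λ a → classNeighbour? a v

    inSmallClass? : Decidable (λ v → size c (c v) ≤ suc t)
    inSmallClass? v = size c (c v) ≤? suc t

    count-adjacentToClass≤t*Δ : count adjacentToClass? ≤ t * Δ
    count-adjacentToClass≤t*Δ = begin
      count adjacentToClass?
        ≤⟨ count-∃ classNeighbour? ⟩
      ∑[ a < n ] count (classNeighbour? a)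
        ≡⟨ sum-cong-≗ (λ a → count-×ˡ (c a ≟ i₀) (neighbour? G a)) ⟩
      ∑[ a < n ] (𝟙 (c a ≟ i₀) * count (neighbour? G a))
        ≤⟨ sum-mono-≤ (λ a → *-monoʳ-≤ (𝟙 (c a ≟ i₀)) (count-neighbour≤Δ G a)) ⟩
      ∑[ a < n ] (𝟙 (c a ≟ i₀) * Δ)
        ≡⟨ *-distribʳ-sum Δ (λ a → 𝟙 (c a ≟ i₀)) ⟨
      size c i₀ * Δ
        ≤⟨ *-monoˡ-≤ Δ small ⟩
      t * Δ
        ∎
      where open ≤-Reasoning

    count-inSmallClass<[1+t]*χ : count inSmallClass? < suc t * χ
    count-inSmallClass<[1+t]*χ = begin-strict
      count inSmallClass?
        ≡⟨ count-fibres inSmallClass? c ⟩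
      ∑[ j < χ ] count (fibre? j)
        ≡⟨ sum-cong-≗ (λ j → count-cong (fibre? j) (fibre′? j) (same-class j)) ⟩
      ∑[ j < χ ] count (fibre′? j)
        ≡⟨ sum-cong-≗ (λ j → count-×ˡ (size c j ≤? suc t) (λ v → c v ≟ j)) ⟩
      ∑[ j < χ ] (𝟙 (size c j ≤? suc t) * size c j)
        <⟨ sum-mono-< i₀ (λ j → 𝟙*≤ (size c j ≤? suc t) id)
                         (s≤s (𝟙*≤ (size c i₀ ≤? suc t) (λ _ → small))) ⟩
      ∑[ j < χ ] suc t
        ≡⟨ sum-const χ (suc t) ⟩
      χ * suc t
        ≡⟨ *-comm χ (suc t) ⟩
      suc t * χ
        ∎
      where
      open ≤-Reasoning
      fibre? : (j : Fin χ) → Decidable (λ v → size c (c v) ≤ suc t × c v ≡ j)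
      fibre? j v = inSmallClass? v ×-dec c v ≟ j
      fibre′? : (j : Fin χ) → Decidable (λ v → size c j ≤ suc t × c v ≡ j)
      fibre′? j v = (size c j ≤? suc t) ×-dec c v ≟ j
      same-class : ∀ j → (λ v → size c (c v) ≤ suc t × c v ≡ j) ≐ (λ v → size c j ≤ suc t × c v ≡ j)
      same-class j = (λ { (s , refl) → s , refl }) , (λ { (s , refl) → s , refl })

    movable-vertex : t * Δ + suc t * χ ≤ n →
                     ∃ λ v → ¬ AdjacentToClass c i₀ v × suc t < size c (c v)
    movable-vertex room =
      let v , ¬bad = count<⇒∃¬ bad? count-bad<n in v , ¬bad ∘ inj₁ , ≰⇒> (¬bad ∘ inj₂)
      where
      bad? : Decidable (λ v → AdjacentToClass c i₀ v ⊎ size c (c v) ≤ suc t)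
      bad? v = adjacentToClass? v ⊎-dec inSmallClass? v
      count-bad<n : count bad? < n
      count-bad<n = begin-strict
        count bad?                                    ≤⟨ count-∪ adjacentToClass? inSmallClass? ⟩
        count adjacentToClass? + count inSmallClass?  <⟨ +-mono-≤-< count-adjacentToClass≤t*Δ
                                                                     count-inSmallClass<[1+t]*χ ⟩
        t * Δ + suc t * χ                             ≤⟨ room ⟩
        n                                             ∎
        where open ≤-Reasoning

  module Move (c : Fin n → Fin χ) (proper : Proper G c) (i₀ : Fin χ) (small : size c i₀ ≤ t)
              (v : Fin n) (far : ¬ AdjacentToClass c i₀ v) (large : suc t < size c (c v)) where

    c′ : Fin n → Fin χ
    c′ = updateAt c v (const i₀)

    c′-at : c′ v ≡ i₀
    c′-at = updateAt-updates v c

    c′-off : ∀ {u} → u ≢ v → c′ u ≡ c u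
    c′-off {u} u≢v = updateAt-minimal u v c u≢v

    proper′ : Proper G c′
    proper′ u w u~w with u ≟ v | w ≟ v
    ... | yes refl | yes refl = λ _ → contradiction (trans (sym u~w) (irrefl G v)) λ ()
    ... | yes refl | no w≢v   = λ c′v≡c′w →
      far (w , trans (sym (c′-off w≢v)) (trans (sym c′v≡c′w) c′-at) ,
               trans (Graph.sym G w v) u~w)
    ... | no u≢v   | yes refl = λ c′u≡c′v →
      far (u , trans (sym (c′-off u≢v)) (trans c′u≡c′v c′-at) , u~w)
    ... | no u≢v   | no w≢v   = λ c′u≡c′w →
      proper u w u~w (trans (sym (c′-off u≢v)) (trans c′u≡c′w (c′-off w≢v)))

    i₀≢cv : i₀ ≢ c v
    i₀≢cv i₀≡cv = ≤⇒≯ (subst (λ i → size c i ≤ t) i₀≡cv small) (<-trans (n<1+n t) large)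

    size-shift : ∀ q → 𝟙 (c v ≟ q) + size c′ q ≡ 𝟙 (i₀ ≟ q) + size c q
    size-shift q = subst (λ i → 𝟙 (c v ≟ q) + size c′ q ≡ 𝟙 (i ≟ q) + size c q) c′-at
      (count-cong-except (λ u → c′ u ≟ q) (λ u → c u ≟ q) v
        λ u≢v → mk⇔ (trans (sym (c′-off u≢v))) (trans (c′-off u≢v)))

    deficit-nonincreasing : ∀ q → deficit c′ q ≤ deficit c q
    deficit-nonincreasing q with c v ≟ q | i₀ ≟ q | size-shift q
    ... | yes refl | yes i₀≡cv | _     = contradiction i₀≡cv i₀≢cv
    ... | yes refl | no _      | shift =
      subst (_≤ suc t ∸ size c (c v)) (sym (m≤n⇒m∸n≡0 still-large)) z≤n
      where
      still-large : suc t ≤ size c′ (c v)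
      still-large = ≤-pred (subst (suc t <_) (sym shift) large)
    ... | no _     | _         | shift =
      ∸-monoʳ-≤ (suc t) (≤-trans (m≤n+m (size c q) _) (≤-reflexive (sym shift)))

    deficit-decreases-at-i₀ : deficit c′ i₀ < deficit c i₀
    deficit-decreases-at-i₀ with c v ≟ i₀ | i₀ ≟ i₀ | size-shift i₀
    ... | yes cv≡i₀ | _        | _     = contradiction (sym cv≡i₀) i₀≢cv
    ... | no _      | no i₀≢i₀ | _     = contradiction refl i₀≢i₀
    ... | no _      | yes _    | shift =
      ∸-monoʳ-< (≤-reflexive (sym shift)) (≤-trans (≤-reflexive shift) (s≤s small))

    imbalance-decreases : imbalance c′ < imbalance c
    imbalance-decreases = sum-mono-< i₀ deficit-nonincreasing deficit-decreases-at-i₀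

  improve : t * Δ + suc t * χ ≤ n → (c : Fin n → Fin χ) → Proper G c →
            (i₀ : Fin χ) → size c i₀ ≤ t → ∃ λ c′ → Proper G c′ × imbalance c′ < imbalance c
  improve room c proper i₀ small =
    let v , far , large = movable-vertex c i₀ small room
        open Move c proper i₀ small v far large
    in c′ , proper′ , imbalance-decreases

  balance : t * Δ + suc t * χ ≤ n → (c : Fin n → Fin χ) → Proper G c →
            ∃ λ c′ → Proper G c′ × ∀ i → t < classSize c′ i
  balance room c proper = go c proper (<-wellFounded (imbalance c))
    where
    go : (c : Fin n → Fin _) → Proper G c → Acc _<_ (imbalance c) →
         ∃ λ c′ → Proper G c′ × ∀ i → t < classSize c′ i
    go c proper (acc smaller) with any? (λ i → size c i ≤? t)
    ... | yes (i₀ , small) =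
      let c′ , proper′ , c′<c = improve room c proper i₀ small in go c′ proper′ (smaller c′<c)
    ... | no none-small    =
      c , proper , λ i → subst (t <_) (sym (classSize≡count c i)) (≰⇒> (none-small ∘ (i ,_)))

lemma3p1 : (n : ℕ) (G : Graph n) (χ : ℕ) → IsChromaticNumber G χ →
    9 * maxDegree G + 3 < n →
    Σ (Fin n → Fin χ) (λ c → Proper G c × ((i : Fin χ) → 4 ≤ classSize c i))
lemma3p1 n G χ isχ@((c , proper) , _) 9Δ+3<n = Balancing.balance G 3 room c proper
  where
  Δ : ℕ
  Δ = maxDegree G
  room : 3 * Δ + 4 * χ ≤ n
  room = begin
    3 * Δ + 4 * χ              ≤⟨ +-monoʳ-≤ (3 * Δ) (*-monoʳ-≤ 4 (χ≤1+Δ G isχ)) ⟩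
    3 * Δ + 4 * suc Δ          ≤⟨ m≤m+n _ (2 * Δ) ⟩
    3 * Δ + 4 * suc Δ + 2 * Δ  ≡⟨ solve 1 (λ d → con 3 :* d :+ con 4 :* (con 1 :+ d) :+ con 2 :* d
                                                   := con 1 :+ (con 9 :* d :+ con 3)) refl Δ ⟩
    suc (9 * Δ + 3)            ≤⟨ 9Δ+3<n ⟩
    n                          ∎
    where
    open ≤-Reasoning
    open +-*-Solver
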